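{- Let $G$ be a graph, $k$ a positive integer, $c$ a $k$-colouring of $G$, and $u,v$ distinct vertices of $G$ with $|C_{c,u}|\geq 2$ and $|C_{c,v}|\geq 2$. Then $c_u\in C_{c,u}$ and $c_v\in C_{c,v}$ satisfy condition $(\star\star\star)$ if and only if $|C_{c_u,v}|\geq 2$, $|C_{c_v,u}|\geq 2$, and $C_{c_u,v}\cap C_{c_v,u}\neq\varnothing$.
   Context: A (proper) $k$-colouring of $G$ is a map $V(G)\to[k]$ giving adjacent vertices different colours. A Kempe swap, for colours $i\neq j$, exchanges $i$ and $j$ on one connected component of the subgraph induced by the vertices coloured $i$ or $j$. $\mathcal{K}_k(G)$ is the graph on the $k$-colourings of $G$, two adjacent iff they differ by one Kempe swap. For a $k$-colouring $d$ and a vertex $w$, $C_{d,w}$ is the set of $k$-colourings differing from $d$ exactly at $w$. Condition $(\star\star\star)$ for $c_u\in C_{c,u}$, $c_v\in C_{c,v}$: $c_u$ and $c_v$ have a common neighbour $x\neq c$ in $\mathcal{K}_k(G)$, and there exist colourings $c_u'$ and $c_v'$ (each adjacent to $c_u$, resp. $c_v$) such that $\{x,c_u,c_u'\}$ and $\{x,c_v,c_v'\}$ both induce triangles in $\mathcal{K}_k(G)$. -}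

module Defs where

open import Data.Nat using (ℕ; _≥_)
open import Data.Fin using (Fin)
open import Data.Product using (Σ; ∃; _×_; _,_)
open import Data.Sum using (_⊎_)
open import Relation.Nullary using (¬_; Dec)
open import Relation.Binary.PropositionalEquality using (_≡_)

record Graph : Set₁ where
  field
    n      : ℕ
    Adj    : Fin n → Fin n → Set
    adj?   : ∀ x y → Dec (Adj x y)
    sym    : ∀ {x y} → Adj x y → Adj y x
    irrefl : ∀ {x} → ¬ Adj x x
open Graph public

module _ (G : Graph) (k : ℕ) where

  record Colouring : Set where
    constructor colouring
    field
      col    : Fin (n G) → Fin k
      proper : ∀ {x y} → Adj G x y → ¬ (col x ≡ col y)
  open Colouring public

  _≈_ : Colouring → Colouring → Set
  c ≈ d = ∀ x → col c x ≡ col d x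

  -- Reach c i j a y : y lies in the connected component containing a of the
  -- subgraph of G induced by the vertices coloured i or j under c.
  data Reach (c : Colouring) (i j : Fin k) (a : Fin (n G)) : Fin (n G) → Set where
    here : (col c a ≡ i ⊎ col c a ≡ j) → Reach c i j a a
    step : ∀ {y z} → Reach c i j a y → Adj G y z →
           (col c z ≡ i ⊎ col c z ≡ j) → Reach c i j a z

  KempeSwap : Colouring → Fin k → Fin k → Fin (n G) → Colouring → Set
  KempeSwap c i j a d =
    ¬ (i ≡ j) × (col c a ≡ i ⊎ col c a ≡ j) ×
    (∀ y → (Reach c i j a y →
              (col c y ≡ i → col d y ≡ j) × (col c y ≡ j → col d y ≡ i))
         × (¬ Reach c i j a y → col d y ≡ col c y))

  KAdj : Colouring → Colouring → Set
  KAdj c d = Σ (Fin k) λ i → Σ (Fin k) λ j → Σ (Fin (n G)) λ a → KempeSwap c i j a d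

  -- {a, b, e} induces a triangle in 𝒦_k(G) (pairwise adjacent; adjacency
  -- in 𝒦_k(G) forces distinctness).
  Triangle : Colouring → Colouring → Colouring → Set
  Triangle a b e = KAdj a b × KAdj b e × KAdj a e

  -- d' ∈ C_{d,w}: d' differs from d exactly at w.
  InC : Colouring → Fin (n G) → Colouring → Set
  InC d w d' = ¬ (col d' w ≡ col d w) × (∀ x → ¬ (x ≡ w) → col d' x ≡ col d x)

  AtLeastTwo : Colouring → Fin (n G) → Set
  AtLeastTwo d w = Σ Colouring λ e₁ → Σ Colouring λ e₂ →
                   InC d w e₁ × InC d w e₂ × ¬ (e₁ ≈ e₂)

  Meets : Colouring → Fin (n G) → Colouring → Fin (n G) → Set
  Meets d w d' w' = Σ Colouring λ e → InC d w e × InC d' w' e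

  Star3 : Colouring → Colouring → Colouring → Set
  Star3 c cu cv =
    Σ Colouring λ x → KAdj cu x × KAdj cv x × ¬ (x ≈ c) ×
      (Σ Colouring λ cu' → KAdj cu cu' × Triangle x cu cu') ×
      (Σ Colouring λ cv' → KAdj cv cv' × Triangle x cv cv')

-- Two colourings a, b that are adjacent in 𝒦_k(G) and have a common neighbour d differ at a single
-- vertex. Let K be the Kempe chain swapped from a to b. Every vertex t of K lies in the chain L
-- swapped from a to d: otherwise d t = a t ≠ b t, so t lies in the chain swapped from b to d, which
-- then is K with the same colours at t, giving d = a. If K had vertices of both colours, L would
-- carry the same two colours, so a ↦ b and a ↦ d would be the same swap and b = d; being connected,
-- K is then a single vertex. Conversely, recolouring one vertex is a swap of a one-vertex chain.
-- Hence in (⋆⋆⋆) the colourings x and c_u′ lie in C_{c_u,w}, x lies in C_{c_v,w′}, and x ≠ c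
-- forces w = v and w′ = u.

{-# OPTIONS --safe #-}
module Submission where

open import Defs
open import Data.Nat using (ℕ; _≥_)
open import Data.Fin using (Fin)
open import Data.Fin.Properties using (_≟_)
open import Data.Product using (Σ; ∃; _×_; _,_; proj₁; proj₂)
open import Data.Sum using (_⊎_; inj₁; inj₂)
import Data.Sum as Sum
open import Data.Empty using (⊥; ⊥-elim)
open import Function using (_∘_)
open import Relation.Nullary using (¬_; Dec; yes; no)
open import Relation.Nullary.Decidable using (decidable-stable; _⊎-dec_)
open import Relation.Binary.PropositionalEquality
  using (_≡_; _≢_; refl; trans; subst; subst₂; ≢-sym) renaming (sym to ≡-sym)
open import Function.Bundles using (_⇔_; mk⇔)

by-cases : {A P : Set} → Dec P → (A → P) → (¬ A → P) → P
by-cases P? if-A if-¬A = decidable-stable P? (λ ¬p → ¬p (if-¬A (¬p ∘ if-A)))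

module Kempe (G : Graph) (k : ℕ) where

  private
    variable
      a b c d x cu cv : Colouring G k
      i j i′ j′ p q : Fin k
      t u v w w′ w″ y z : Fin (n G)

  _≉_ : Colouring G k → Colouring G k → Set
  a ≉ b = ¬ _≈_ G k a b

  ColouredIn : Colouring G k → Fin k → Fin k → Fin (n G) → Set
  ColouredIn a i j y = col a y ≡ i ⊎ col a y ≡ j

  reach-coloured : Reach G k a i j w y → ColouredIn a i j y
  reach-coloured (here c)     = c
  reach-coloured (step _ _ c) = c

  reach-trans : Reach G k a i j w y → Reach G k a i j y z → Reach G k a i j w z
  reach-trans r (here _)     = r
  reach-trans r (step s e c) = step (reach-trans r s) e c

  reach-sym : Reach G k a i j w y → Reach G k a i j y w
  reach-sym (here c)     = here c
  reach-sym (step r e c) = reach-trans (step (here c) (sym G e) (reach-coloured r)) (reach-sym r)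

  reach-map : (∀ {x} → ColouredIn a i j x → ColouredIn b p q x) →
              Reach G k a i j w y → Reach G k b p q w y
  reach-map f (here c)     = here (f c)
  reach-map f (step r e c) = step (reach-map f r) e (f c)

  reach-swap : Reach G k a i j w y → Reach G k a j i w y
  reach-swap = reach-map Sum.swap

  data Exchanged (a b : Colouring G k) (i j : Fin k) (y : Fin (n G)) : Set where
    i↦j : col a y ≡ i → col b y ≡ j → Exchanged a b i j y
    j↦i : col a y ≡ j → col b y ≡ i → Exchanged a b i j y

  exchanged-sym : Exchanged a b i j y → Exchanged b a i j y
  exchanged-sym (i↦j ai bj) = j↦i bj ai
  exchanged-sym (j↦i aj bi) = i↦j bi aj

  exchanged-swap : Exchanged a b i j y → Exchanged a b j i y
  exchanged-swap (i↦j ai bj) = j↦i ai bj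
  exchanged-swap (j↦i aj bi) = i↦j aj bi

  exchanged-coloured : Exchanged a b i j y → ColouredIn b i j y
  exchanged-coloured (i↦j _ bj) = inj₂ bj
  exchanged-coloured (j↦i _ bi) = inj₁ bi

  exchanged-≢ : i ≢ j → Exchanged a b i j y → col b y ≢ col a y
  exchanged-≢ i≢j (i↦j ai bj) b≡a = i≢j (trans (≡-sym ai) (trans (≡-sym b≡a) bj))
  exchanged-≢ i≢j (j↦i aj bi) b≡a = i≢j (trans (≡-sym bi) (trans b≡a aj))

  exchanged-unique : Exchanged a b i j y → Exchanged a d i j y → col b y ≡ col d y
  exchanged-unique (i↦j _  bj) (i↦j _  dj) = trans bj (≡-sym dj)
  exchanged-unique (i↦j ai bj) (j↦i aj di) = trans bj (trans (≡-sym aj) (trans ai (≡-sym di)))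
  exchanged-unique (j↦i aj bi) (i↦j ai dj) = trans bi (trans (≡-sym ai) (trans aj (≡-sym dj)))
  exchanged-unique (j↦i _  bi) (j↦i _  di) = trans bi (≡-sym di)

  exchanged-other : Exchanged a b i j y → ColouredIn a i j z →
                    col a y ≢ col a z → col b y ≡ col a z
  exchanged-other (i↦j ai _)  (inj₁ azi) ay≢az = ⊥-elim (ay≢az (trans ai (≡-sym azi)))
  exchanged-other (i↦j _  bj) (inj₂ azj) _     = trans bj (≡-sym azj)
  exchanged-other (j↦i _  bi) (inj₁ azi) _     = trans bi (≡-sym azi)
  exchanged-other (j↦i aj _)  (inj₂ azj) ay≢az = ⊥-elim (ay≢az (trans aj (≡-sym azj)))

  -- KempeSwap and InC unfold to Σ-types from which Agda cannot infer the colourings involved;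
  -- Swap and Recolouring are equivalent records, Swap describing the chain through Exchanged.
  record Swap (a : Colouring G k) (i j : Fin k) (w : Fin (n G)) (b : Colouring G k) : Set where
    field
      distinct : i ≢ j
      root     : ColouredIn a i j w
      inside   : Reach G k a i j w y → Exchanged a b i j y
      outside  : ¬ Reach G k a i j w y → col b y ≡ col a y

  open Swap

  KempeSwap⇒Swap : KempeSwap G k a i j w b → Swap a i j w b
  KempeSwap⇒Swap {a = a} {i = i} {j = j} {b = b} (i≢j , cw , h) = record
    { distinct = i≢j
    ; root     = cw
    ; inside   = λ {y} r → recolouring (reach-coloured r) (proj₁ (h y) r)
    ; outside  = λ {y} → proj₂ (h y)
    }
    where
    recolouring : ColouredIn a i j y → (col a y ≡ i → col b y ≡ j) × (col a y ≡ j → col b y ≡ i) →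
                  Exchanged a b i j y
    recolouring (inj₁ ai) (to-j , _) = i↦j ai (to-j ai)
    recolouring (inj₂ aj) (_ , to-i) = j↦i aj (to-i aj)

  Swap⇒KempeSwap : Swap a i j w b → KempeSwap G k a i j w b
  Swap⇒KempeSwap {a = a} {i = i} {j = j} {b = b} S =
    distinct S , root S , λ y → (λ r → recolouring (inside S r)) , outside S
    where
    recolouring : Exchanged a b i j y →
                  (col a y ≡ i → col b y ≡ j) × (col a y ≡ j → col b y ≡ i)
    recolouring (i↦j ai bj) = (λ _ → bj) , (λ aj → ⊥-elim (distinct S (trans (≡-sym ai) aj)))
    recolouring (j↦i aj bi) = (λ ai → ⊥-elim (distinct S (trans (≡-sym ai) aj))) , (λ _ → bi)

  swap-changes : Swap a i j w b → Reach G k a i j w y → col b y ≢ col a y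
  swap-changes S r = exchanged-≢ (distinct S) (inside S r)

  swap-≉ : Swap a i j w b → a ≉ b
  swap-≉ S a≈b = swap-changes S (here (root S)) (≡-sym (a≈b _))

  KAdj-≉ : KAdj G k a b → a ≉ b
  KAdj-≉ {b = b} (_ , _ , _ , K) = swap-≉ (KempeSwap⇒Swap {b = b} K)

  swap-keeps-colours : Swap a i j w b → ColouredIn a i j y → ColouredIn b i j y
  swap-keeps-colours {i = i} {j = j} {b = b} {y = y} S c =
    by-cases ((col b y ≟ i) ⊎-dec (col b y ≟ j))
      (λ r → exchanged-coloured (inside S r))
      (λ ¬r → subst (λ x → x ≡ i ⊎ x ≡ j) (≡-sym (outside S ¬r)) c)

  swap-keeps-colours⁻ : Swap a i j w b → ColouredIn b i j y → ColouredIn a i j y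
  swap-keeps-colours⁻ {a = a} {i = i} {j = j} {y = y} S c =
    by-cases ((col a y ≟ i) ⊎-dec (col a y ≟ j))
      reach-coloured
      (λ ¬r → subst (λ x → x ≡ i ⊎ x ≡ j) (outside S ¬r) c)

  swap-sym : Swap a i j w b → Swap b i j w a
  swap-sym S = record
    { distinct = distinct S
    ; root     = swap-keeps-colours S (root S)
    ; inside   = exchanged-sym ∘ inside S ∘ reach-map (swap-keeps-colours⁻ S)
    ; outside  = λ ¬r → ≡-sym (outside S (¬r ∘ reach-map (swap-keeps-colours S)))
    }

  KAdj-sym : KAdj G k a b → KAdj G k b a
  KAdj-sym {b = b} (i , j , w , K) =
    i , j , w , Swap⇒KempeSwap (swap-sym (KempeSwap⇒Swap {b = b} K))

  swap-flip : Swap a i j w b → Swap a j i w b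
  swap-flip S = record
    { distinct = ≢-sym (distinct S)
    ; root     = Sum.swap (root S)
    ; inside   = exchanged-swap ∘ inside S ∘ reach-swap
    ; outside  = λ ¬r → outside S (¬r ∘ reach-swap)
    }

  swap-reroot : Swap a i j w b → Reach G k a i j w t → Swap a i j t b
  swap-reroot S rt = record
    { distinct = distinct S
    ; root     = reach-coloured rt
    ; inside   = inside S ∘ reach-trans rt
    ; outside  = λ ¬r → outside S (¬r ∘ reach-trans (reach-sym rt))
    }

  swap-normalise : Swap a i j w b → Reach G k a i j w t → Swap a (col a t) (col b t) t b
  swap-normalise {a = a} {b = b} {t = t} S rt with inside S rt
  ... | i↦j ai bj = subst₂ (λ p q → Swap a p q t b) (≡-sym ai) (≡-sym bj) (swap-reroot S rt)
  ... | j↦i aj bi =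
    subst₂ (λ p q → Swap a p q t b) (≡-sym aj) (≡-sym bi) (swap-flip (swap-reroot S rt))

  swap-unique : Swap a i j w b → Swap a i j w d → _≈_ G k b d
  swap-unique {b = b} {d = d} S S′ y =
    by-cases (col b y ≟ col d y)
      (λ r → exchanged-unique (inside S r) (inside S′ r))
      (λ ¬r → trans (outside S ¬r) (≡-sym (outside S′ ¬r)))

  swap-determined : Swap a i j w b → Swap a p q w′ d →
                    Reach G k a i j w t → Reach G k a p q w′ t → col b t ≡ col d t →
                    _≈_ G k b d
  swap-determined {a = a} {d = d} {t = t} S S′ rt rt′ bt≡dt =
    swap-unique (swap-normalise S rt)
      (subst (λ x → Swap a (col a t) x t d) (≡-sym bt≡dt) (swap-normalise S′ rt′))

  triangle-chain-⊆ : Swap a i j w b → Swap a p q w′ d → Swap b i′ j′ w″ d →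
                     Reach G k a i j w t → ¬ ¬ Reach G k a p q w′ t
  triangle-chain-⊆ {a = a} {b = b} {d = d} {i′ = i′} {j′ = j′} {w″ = w″} {t = t} S T U rt ¬rt′ =
    outside-U inside-U
    where
    dt≡at : col d t ≡ col a t
    dt≡at = outside T ¬rt′
    inside-U : ¬ Reach G k b i′ j′ w″ t
    inside-U ru =
      swap-≉ T (swap-determined (swap-sym S) U (reach-map (swap-keeps-colours S) rt) ru
                                (≡-sym dt≡at))
    outside-U : ¬ ¬ Reach G k b i′ j′ w″ t
    outside-U ¬ru = swap-changes S rt (trans (≡-sym (outside U ¬ru)) dt≡at)

  triangle-chain-monochromatic : Swap a i j w b → Swap a p q w′ d → Swap b i′ j′ w″ d →
                                 Reach G k a i j w y → Reach G k a i j w z → col a y ≡ col a z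
  triangle-chain-monochromatic {a = a} {y = y} {z = z} S T U ry rz =
    decidable-stable (col a y ≟ col a z) λ ay≢az →
      triangle-chain-⊆ S T U ry λ ry′ → triangle-chain-⊆ S T U rz λ rz′ →
        swap-≉ U (swap-determined S T ry ry′
          (trans (exchanged-other (inside S ry) (reach-coloured rz) ay≢az)
                 (≡-sym (exchanged-other (inside T ry′) (reach-coloured rz′) ay≢az))))

  triangle-chain-trivial : Swap a i j w b → Swap a p q w′ d → Swap b i′ j′ w″ d →
                           Reach G k a i j w t → t ≡ w
  triangle-chain-trivial S T U (here _) = refl
  triangle-chain-trivial {a = a} S T U (step r e c) =
    ⊥-elim (proper a e (triangle-chain-monochromatic S T U r (step r e c)))

  record Recolouring (a : Colouring G k) (w : Fin (n G)) (b : Colouring G k) : Set where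
    field
      changed   : col b w ≢ col a w
      unchanged : y ≢ w → col b y ≡ col a y

  open Recolouring

  InC⇒Recolouring : InC G k a w b → Recolouring a w b
  InC⇒Recolouring (bw≢aw , agree) = record { changed = bw≢aw ; unchanged = agree _ }

  Recolouring⇒InC : Recolouring a w b → InC G k a w b
  Recolouring⇒InC R = changed R , λ _ → unchanged R

  KAdj-triangle⇒Recolouring : KAdj G k a b → KAdj G k a d → KAdj G k b d →
                              ∃ λ w → Recolouring a w b
  KAdj-triangle⇒Recolouring {b = b} {d = d} (_ , _ , w , K) (_ , _ , _ , L) (_ , _ , _ , M) =
    w , record { changed = swap-changes S (here (root S))
               ; unchanged = λ y≢w → outside S (y≢w ∘ triangle-chain-trivial S T U) }
    where
    S = KempeSwap⇒Swap {b = b} K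
    T = KempeSwap⇒Swap {b = d} L
    U = KempeSwap⇒Swap {b = d} M

  recolouring-chain-trivial : Recolouring a w b → Reach G k a (col a w) (col b w) w t → t ≡ w
  recolouring-chain-trivial _ (here _) = refl
  recolouring-chain-trivial {a = a} {w = w} {b = b} R (step {z = z} r e c)
    with recolouring-chain-trivial R r
  ... | refl = ⊥-elim (neighbour-colour c)
    where
    neighbour-colour : ColouredIn a (col a w) (col b w) z → ⊥
    neighbour-colour (inj₁ az≡aw) = proper a e (≡-sym az≡aw)
    neighbour-colour (inj₂ az≡bw) =
      proper b e (≡-sym (trans (unchanged R (λ { refl → irrefl G e })) az≡bw))

  recolouring⇒swap : Recolouring a w b → Swap a (col a w) (col b w) w b
  recolouring⇒swap {a = a} {w = w} {b = b} R = record
    { distinct = ≢-sym (changed R)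
    ; root     = inj₁ refl
    ; inside   = λ r → only-w (recolouring-chain-trivial R r)
    ; outside  = λ ¬r → unchanged R (λ { refl → ¬r (here (inj₁ refl)) })
    }
    where
    only-w : t ≡ w → Exchanged a b (col a w) (col b w) t
    only-w refl = i↦j refl refl

  recolouring⇒KAdj : Recolouring a w b → KAdj G k a b
  recolouring⇒KAdj R = _ , _ , _ , Swap⇒KempeSwap (recolouring⇒swap R)

  recolouring-sym : Recolouring a w b → Recolouring b w a
  recolouring-sym R = record { changed = changed R ∘ ≡-sym ; unchanged = ≡-sym ∘ unchanged R }

  recolouring-only : Recolouring a w b → col b y ≢ col a y → y ≡ w
  recolouring-only {w = w} {y = y} R by≢ay = decidable-stable (y ≟ w) (by≢ay ∘ unchanged R)

  recolouring-≈ : Recolouring a w b → Recolouring a w d → col b w ≡ col d w → _≈_ G k b d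
  recolouring-≈ {w = w} R R′ bw≡dw y with y ≟ w
  ... | yes refl = bw≡dw
  ... | no y≢w   = trans (unchanged R y≢w) (≡-sym (unchanged R′ y≢w))

  recolouring-rebase : Recolouring a w b → Recolouring a w d → col d w ≢ col b w →
                       Recolouring b w d
  recolouring-rebase R R′ dw≢bw = record
    { changed   = dw≢bw
    ; unchanged = λ y≢w → trans (unchanged R′ y≢w) (≡-sym (unchanged R y≢w))
    }

  recolouring-triangle : Recolouring a w b → Recolouring b w′ d → Recolouring a w″ d → w ≡ w′
  recolouring-triangle {a = a} {w = w} {b = b} {w′ = w′} {d = d} Rab Rbd Rad with w ≟ w′
  ... | yes w≡w′ = w≡w′
  ... | no w≢w′  =
    ⊥-elim (w≢w′ (trans (recolouring-only Rad dw≢aw) (≡-sym (recolouring-only Rad dw′≢aw′))))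
    where
    dw≢aw : col d w ≢ col a w
    dw≢aw dw≡aw = changed Rab (trans (≡-sym (unchanged Rbd w≢w′)) dw≡aw)
    dw′≢aw′ : col d w′ ≢ col a w′
    dw′≢aw′ dw′≡aw′ = changed Rbd (trans dw′≡aw′ (≡-sym (unchanged Rab (w≢w′ ∘ ≡-sym))))

  recolouring-square : u ≢ v → Recolouring c u cu → Recolouring c v cv →
                       Recolouring cu w x → Recolouring cv w′ x → x ≉ c → w ≡ v
  recolouring-square {u = u} {v = v} {c = c} {w = w} {x = x} {w′ = w′} u≢v Rcu Rcv Rx Rx′ x≉c
    with w ≟ v
  ... | yes w≡v = w≡v
  ... | no w≢v  = ⊥-elim (x≉c x≈c)
    where
    xv≡cv : col x v ≡ col c v
    xv≡cv = trans (unchanged Rx (w≢v ∘ ≡-sym)) (unchanged Rcu (u≢v ∘ ≡-sym))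
    v≡w′ : v ≡ w′
    v≡w′ = recolouring-only Rx′ (λ xv≡cvv → changed Rcv (trans (≡-sym xv≡cvv) xv≡cv))
    xu≡cu : col x u ≡ col c u
    xu≡cu = trans (unchanged Rx′ (u≢v ∘ λ u≡w′ → trans u≡w′ (≡-sym v≡w′))) (unchanged Rcv u≢v)
    u≡w : u ≡ w
    u≡w = recolouring-only Rx (λ xu≡cuu → changed Rcu (trans (≡-sym xu≡cuu) xu≡cu))
    x≈c : _≈_ G k x c
    x≈c y with y ≟ u
    ... | yes refl = xu≡cu
    ... | no y≢u   = trans (unchanged Rx (y≢u ∘ λ y≡w → trans y≡w (≡-sym u≡w))) (unchanged Rcu y≢u)

  common-neighbour-recolouring : Recolouring a w b → KAdj G k a d → KAdj G k b d →
                                 Recolouring a w d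
  common-neighbour-recolouring {a = a} {w = w} {b = b} {d = d} R ad bd
    with KAdj-triangle⇒Recolouring {b = d} {d = b} ad (recolouring⇒KAdj R) (KAdj-sym {b = d} bd)
       | KAdj-triangle⇒Recolouring {b = d} {d = a} bd
           (KAdj-sym (recolouring⇒KAdj R)) (KAdj-sym {b = d} ad)
  ... | _ , Rad | _ , Rbd =
    subst (λ v → Recolouring a v d) (≡-sym (recolouring-triangle (recolouring-sym R) Rad Rbd)) Rad

  triangle⇒AtLeastTwo : Recolouring a w b → KAdj G k a d → KAdj G k b d → AtLeastTwo G k a w
  triangle⇒AtLeastTwo {b = b} {d = d} R ad bd =
    b , d , Recolouring⇒InC R , Recolouring⇒InC (common-neighbour-recolouring {d = d} R ad bd) ,
    KAdj-≉ {b = d} bd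

  AtLeastTwo⇒common-recolouring : AtLeastTwo G k a w → Recolouring a w b →
                                  ∃ λ d → Recolouring a w d × Recolouring b w d
  AtLeastTwo⇒common-recolouring {w = w} {b = b} (e₁ , e₂ , e₁∈C , e₂∈C , e₁≉e₂) R
    with InC⇒Recolouring {b = e₁} e₁∈C | InC⇒Recolouring {b = e₂} e₂∈C | col e₁ w ≟ col b w
  ... | R₁ | _  | no e₁w≢bw  = e₁ , R₁ , recolouring-rebase R R₁ e₁w≢bw
  ... | R₁ | R₂ | yes e₁w≡bw = e₂ , R₂ , recolouring-rebase R R₂
    (λ e₂w≡bw → e₁≉e₂ (recolouring-≈ R₁ R₂ (trans e₁w≡bw (≡-sym e₂w≡bw))))

  AtLeastTwo⇒triangle : AtLeastTwo G k a w → Recolouring a w b →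
                        Σ (Colouring G k) λ d → KAdj G k a d × Triangle G k b a d
  AtLeastTwo⇒triangle two R with AtLeastTwo⇒common-recolouring two R
  ... | d , Rad , Rbd =
    d , recolouring⇒KAdj Rad ,
    recolouring⇒KAdj (recolouring-sym R) , recolouring⇒KAdj Rad , recolouring⇒KAdj Rbd


  Star3⇒AtLeastTwo×Meets : u ≢ v → Recolouring c u cu → Recolouring c v cv → Star3 G k c cu cv →
                           AtLeastTwo G k cu v × AtLeastTwo G k cv u × Meets G k cu v cv u
  Star3⇒AtLeastTwo×Meets {u = u} {v = v} {c = c} {cu = cu} {cv = cv} u≢v Rcu Rcv
    (x , cu-x , cv-x , x≉c , (cu′ , _ , _ , cu-cu′ , x-cu′) , (cv′ , _ , _ , cv-cv′ , x-cv′))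
    with KAdj-triangle⇒Recolouring {b = x} {d = cu′} cu-x cu-cu′ x-cu′
       | KAdj-triangle⇒Recolouring {b = x} {d = cv′} cv-x cv-cv′ x-cv′
  ... | _ , Rx | _ , Rx′ =
    triangle⇒AtLeastTwo {d = cu′} Rux cu-cu′ x-cu′ ,
    triangle⇒AtLeastTwo {d = cv′} Rvx cv-cv′ x-cv′ ,
    x , Recolouring⇒InC Rux , Recolouring⇒InC Rvx
    where
    Rux : Recolouring cu v x
    Rux = subst (λ w → Recolouring cu w x) (recolouring-square u≢v Rcu Rcv Rx Rx′ x≉c) Rx
    Rvx : Recolouring cv u x
    Rvx = subst (λ w → Recolouring cv w x)
                (recolouring-square (u≢v ∘ ≡-sym) Rcv Rcu Rx′ Rx x≉c) Rx′

  AtLeastTwo×Meets⇒Star3 : u ≢ v → Recolouring c v cv →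
                           AtLeastTwo G k cu v × AtLeastTwo G k cv u × Meets G k cu v cv u →
                           Star3 G k c cu cv
  AtLeastTwo×Meets⇒Star3 {u = u} {v = v} {c = c} {cv = cv} {cu = cu} u≢v Rcv
    (two-cu , two-cv , x , x∈Cu , x∈Cv) =
    x , recolouring⇒KAdj Rux , recolouring⇒KAdj Rvx , x≉c ,
    AtLeastTwo⇒triangle two-cu Rux , AtLeastTwo⇒triangle two-cv Rvx
    where
    Rux : Recolouring cu v x
    Rux = InC⇒Recolouring {b = x} x∈Cu
    Rvx : Recolouring cv u x
    Rvx = InC⇒Recolouring {b = x} x∈Cv
    x≉c : x ≉ c
    x≉c x≈c = changed Rvx (trans (x≈c u) (≡-sym (unchanged Rcv u≢v)))

lemma3p5 : (G : Graph) (k : ℕ) → k ≥ 1 →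
    (c : Colouring G k) (u v : Fin (n G)) → ¬ (u ≡ v) →
    AtLeastTwo G k c u → AtLeastTwo G k c v →
    (cu cv : Colouring G k) → InC G k c u cu → InC G k c v cv →
    Star3 G k c cu cv ⇔
      (AtLeastTwo G k cu v × AtLeastTwo G k cv u × Meets G k cu v cv u)
lemma3p5 G k _ c u v u≢v _ _ cu cv cu∈C cv∈C =
  mk⇔ (Star3⇒AtLeastTwo×Meets u≢v Rcu Rcv) (AtLeastTwo×Meets⇒Star3 u≢v Rcv)
  where
  open Kempe G k
  Rcu : Recolouring c u cu
  Rcu = InC⇒Recolouring {b = cu} cu∈C
  Rcv : Recolouring c v cv
  Rcv = InC⇒Recolouring {b = cv} cv∈C
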